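{- Let $G=(V,E)$ be a graph with $V=\{v_1,\dots,v_n\}$, let $k$ be a positive integer, and let $G'$ be the graph constructed from $(G,k)$ as described in the context. Then the pathwidth of $G'$ is at most $2k+4$.
   Context: A path decomposition of a graph $H$ is a sequence $(X_1,\dots,X_r)$ of subsets of $V(H)$ with $\bigcup_i X_i=V(H)$, every edge contained in some $X_i$, and each vertex appearing in consecutive sets; its width is $\max_i |X_i|$, and the pathwidth is the minimum width over all path decompositions. $\delta(v)$ is the degree of $v$ in $G$, $N[v]$ its closed neighborhood, and $k'=1+kn+\sum_{v\in V}k(\delta(v)+1)$. Construction of $G'$: (1) For each $j\in[k]$ create a cycle $V^j$ on vertices $v^j_1,\dots,v^j_{n^2}$ in this cyclic order; for $a,b\in[n]$ the vertex $v^j_{(b-1)n+a}$ is the copy of $v_a$ in the $b$-th block of line $j$. (2) For each $j\in[k]$, $b\in[n]$ attach to $v^j_{(b-1)n+1}$ a set of $k'-n+1$ new pendant vertices. (3) For each $i\in[n]$: a central vertex $z^i$ with $k'-k(\delta(v_i)+1)$ new pendant vertices; for each $j\in[k]$ independent sets $X^i_j=\{x^{i,j}_w : w\in N[v_i]\}$ and $Y^i_j=\{y^{i,j}_w: w\in N[v_i]\}$, with edges $x^{i,j}_w y^{i,j}_w$ and $z^i y^{i,j}_w$, and each $x^{i,j}_w$ gets $k'-1$ new pendant vertices. (4) For all $i\in[n]$, $j\in[k]$ and $v_a\in N[v_i]$, add the edge $x^{i,j}_{v_a}v^j_{(i-1)n+a}$. (5) Add a universal vertex adjacent to all other vertices.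 -}

module Defs where

open import Data.Nat using (ℕ; zero; suc; _+_; _*_; _∸_; _≤_)
open import Data.Fin using (Fin; toℕ; _≟_)
open import Data.Bool using (Bool; true; false; if_then_else_; _∨_; T)
open import Data.List using (List; map; allFin; length)
open import Data.Nat.ListAction using (sum)
open import Data.List.Membership.Propositional using (_∈_)
open import Data.Product using (Σ; _×_; ∃; ∃-syntax)
open import Data.Sum using (_⊎_)
open import Relation.Nullary using (¬_)
open import Relation.Nullary.Decidable using (⌊_⌋)
open import Relation.Binary.PropositionalEquality using (_≡_)

-- Finite simple (undirected, loopless) graphs on vertex set {v_1..v_n},
-- represented by Fin n (v_{i+1} ↔ i : Fin n).

record Graph (n : ℕ) : Set where
  field
    adj    : Fin n → Fin n → Bool
    sym    : ∀ u v → adj u v ≡ adj v u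
    irrefl : ∀ v → adj v v ≡ false
open Graph public

-- Path decompositions and "pathwidth ≤ w" (width = max bag size, as in
-- the paper, NOT max bag size minus one).
-- A graph is given by a vertex type V and an edge relation E; an edge
-- E u v is the unordered edge {u,v}.

record PathDecomposition (V : Set) (E : V → V → Set) : Set where
  field
    r       : ℕ
    bag     : Fin r → List V
    covers  : ∀ v → ∃[ i ] (v ∈ bag i)
    edges   : ∀ u v → E u v → ∃[ i ] (u ∈ bag i × v ∈ bag i)
    consec  : ∀ v (i j l : Fin r) → toℕ i ≤ toℕ j → toℕ j ≤ toℕ l →
              v ∈ bag i → v ∈ bag l → v ∈ bag j
open PathDecomposition public

PathwidthAtMost : (V : Set) (E : V → V → Set) → ℕ → Set
PathwidthAtMost V E w =
  Σ (PathDecomposition V E) λ P → ∀ i → length (bag P i) ≤ w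

module Construction {n : ℕ} (G : Graph n) (k : ℕ) where

  δ : Fin n → ℕ
  δ i = sum (map (λ w → if adj G i w then 1 else 0) (allFin n))

  N[_]∋_ : Fin n → Fin n → Set
  N[ i ]∋ w = T (⌊ i ≟ w ⌋ ∨ adj G i w)

  k' : ℕ
  k' = 1 + k * n + sum (map (λ i → k * (δ i + 1)) (allFin n))

  -- 0-based position of v^j_{(b-1)n+a} on the cycle V^j (b = block, a = copy of v_a)
  pos : Fin n → Fin n → ℕ
  pos b a = toℕ b * n + toℕ a

  CycNext : ℕ → ℕ → Set
  CycNext p q = (suc p ≡ q) ⊎ ((p ≡ n * n ∸ 1) × (q ≡ 0))

  data V' : Set where
    -- cyc j b a  =  v^j_{(b-1)n+a}
    cyc  : (j : Fin k) (b a : Fin n) → V'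
    pc   : (j : Fin k) (b : Fin n) (t : Fin (k' ∸ n + 1)) → V'
    z    : (i : Fin n) → V'
    pz   : (i : Fin n) (t : Fin (k' ∸ k * (δ i + 1))) → V'
    x    : (i : Fin n) (j : Fin k) (w : Fin n) → N[ i ]∋ w → V'
    y    : (i : Fin n) (j : Fin k) (w : Fin n) → N[ i ]∋ w → V'
    px   : (i : Fin n) (j : Fin k) (w : Fin n) → N[ i ]∋ w → (t : Fin (k' ∸ 1)) → V'
    univ : V'

  data E' : V' → V' → Set where
    cyc-e : ∀ j b a b₁ a₁ → CycNext (pos b a) (pos b₁ a₁) → E' (cyc j b a) (cyc j b₁ a₁)
    pc-e  : ∀ j b a t → toℕ a ≡ 0 → E' (pc j b t) (cyc j b a)
    pz-e  : ∀ i t → E' (pz i t) (z i)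
    xy-e  : ∀ i j w h → E' (x i j w h) (y i j w h)
    zy-e  : ∀ i j w h → E' (z i) (y i j w h)
    px-e  : ∀ i j w h t → E' (px i j w h t) (x i j w h)
    xc-e  : ∀ i j a h → E' (x i j a h) (cyc j i a)
    u-e   : ∀ v → ¬ (v ≡ univ) → E' univ v

-- Sweep along the k cycles simultaneously, position by position, and at each position line by
-- line.  Every bag holds the universal vertex, the centre z^i of the current block, the first
-- vertex of every cycle (it closes the cycle), the current vertex of every cycle, and two more
-- slots: one keeps the vertex x attached to the current cycle vertex, the other lists y and the
-- pendant vertices of x, of the cycle vertex and of z^i one at a time.  These are 2k + 4
-- vertices, and every vertex of G' occupies an interval of bags, so the bags form a path
-- decomposition.  For n = 0 the graph G' is the universal vertex alone.

module Submission where

open import Defs hiding (sym)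
open import Data.Nat using (ℕ; zero; suc; _+_; _*_; _∸_; _≤_; _<_; z≤n; s≤s; _≤?_; _<?_)
open import Data.Nat.Properties
open import Data.Fin as F
  using (Fin; suc; toℕ; fromℕ<; inject₁; inject≤; combine; remQuot; quotient; remainder)
open import Data.Fin.Patterns using (0F; 1F; 2F; 3F)
open import Data.Fin.Properties
  using ( toℕ-injective; toℕ<n; toℕ-fromℕ<; toℕ-inject≤; toℕ-inject₁
        ; toℕ-combine; remQuot-combine; combine-remQuot; combine-injective )
open import Data.List using (List; []; _∷_; _++_; map; length; allFin)
open import Data.List.Properties using (length-map; length-++; length-tabulate)
open import Data.List.Relation.Unary.Any using (here; there)
open import Data.List.Membership.Propositional using (_∈_)
open import Data.List.Membership.Propositional.Properties
  using (∈-map⁺; ∈-map⁻; ∈-++⁺ˡ; ∈-++⁺ʳ; ∈-allFin)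
open import Data.Product using (_×_; _,_; ∃-syntax; proj₁; proj₂)
open import Data.Sum using (_⊎_; inj₁; inj₂)
open import Data.Unit using (⊤; tt)
open import Data.Bool.Properties using (T-irrelevant)
open import Function using (_∘_)
open import Relation.Nullary using (Dec; yes; no; contradiction)
open import Relation.Nullary.Decidable using (T?)
open import Relation.Binary.PropositionalEquality

record Schedule (V : Set) (E : V → V → Set) (w : ℕ) : Set₁ where
  field
    duration        : ℕ
    Slot            : Set
    slots           : List Slot
    ∈-slots         : ∀ σ → σ ∈ slots
    length-slots    : length slots ≤ w
    occupant        : Fin duration → Slot → V
    Alive           : V → Fin duration → Set
    Alive-convex    : ∀ v {i j l : Fin duration} → toℕ i ≤ toℕ j → toℕ j ≤ toℕ l →
                      Alive v i → Alive v l → Alive v j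
    occupant-alive  : ∀ t σ → Alive (occupant t σ) t
    alive-occupant  : ∀ {v t} → Alive v t → ∃[ σ ] occupant t σ ≡ v
    alive-somewhere : ∀ v → ∃[ t ] Alive v t
    edge-alive      : ∀ {u v} → E u v → ∃[ t ] (Alive u t × Alive v t)

schedule→pathwidth : ∀ {V E w} → Schedule V E w → PathwidthAtMost V E w
schedule→pathwidth {V} {E} S =
  decomposition , λ t → ≤-trans (≤-reflexive (length-map (occupant t) slots)) length-slots
  where
  open Schedule S

  bagAt : Fin duration → List V
  bagAt t = map (occupant t) slots

  ∈-bagAt⇒alive : ∀ {v t} → v ∈ bagAt t → Alive v t
  ∈-bagAt⇒alive {t = t} v∈ with ∈-map⁻ (occupant t) v∈
  ... | σ , _ , refl = occupant-alive t σ

  alive⇒∈-bagAt : ∀ {v t} → Alive v t → v ∈ bagAt t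
  alive⇒∈-bagAt {t = t} alive with alive-occupant alive
  ... | σ , refl = ∈-map⁺ (occupant t) (∈-slots σ)

  decomposition : PathDecomposition V E
  decomposition = record
    { r      = duration
    ; bag    = bagAt
    ; covers = λ v → let (t , alive) = alive-somewhere v in t , alive⇒∈-bagAt alive
    ; edges  = λ u v uv → let (t , au , av) = edge-alive uv in t , alive⇒∈-bagAt au , alive⇒∈-bagAt av
    ; consec = λ v i j l i≤j j≤l v∈i v∈l →
        alive⇒∈-bagAt (Alive-convex v i≤j j≤l (∈-bagAt⇒alive v∈i) (∈-bagAt⇒alive v∈l))
    }

lex-< : ∀ {m a a' c c'} → c < m → a < a' → m * a + c < m * a' + c'
lex-< {m} {a} {a'} {c} {c'} c<m a<a' = begin-strict
  m * a + c   <⟨ +-monoʳ-< (m * a) c<m ⟩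
  m * a + m   ≡⟨ +-comm (m * a) m ⟩
  m + m * a   ≡⟨ *-suc m a ⟨
  m * suc a   ≤⟨ *-monoʳ-≤ m a<a' ⟩
  m * a'      ≤⟨ m≤m+n (m * a') c' ⟩
  m * a' + c' ∎
  where open ≤-Reasoning

lex-<-boundary : ∀ {m a a' c} → c < m → a < a' → m * a + c < m * a'
lex-<-boundary {m} {a} {a'} {c} c<m a<a' = subst (m * a + c <_) (+-identityʳ (m * a')) (lex-< c<m a<a')

lex-≤⇒≤ : ∀ {m a a' c c'} → m * a + c ≤ m * a' + c' → c' < m → a ≤ a'
lex-≤⇒≤ {a = a} {a'} le c'<m with a ≤? a'
... | yes a≤a' = a≤a'
... | no a≰a'  = contradiction le (<⇒≱ (lex-< c'<m (≰⇒> a≰a')))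

lex-<⇒< : ∀ {m a a' c c'} → m * a + c < m * a' + c' → c' ≤ c → a < a'
lex-<⇒< {m} {a} {a'} lt c'≤c with suc a ≤? a'
... | yes a<a' = a<a'
... | no a≮a'  = contradiction lt (≤⇒≯ (+-mono-≤ (*-monoʳ-≤ m (≮⇒≥ a≮a')) c'≤c))

lex-injective : ∀ {m a a' c c'} → c < m → c' < m → m * a + c ≡ m * a' + c' → a ≡ a' × c ≡ c'
lex-injective {m} {a} {a'} {c} {c'} c<m c'<m eq =
  a≡a' , +-cancelˡ-≡ (m * a) c c' (trans eq (cong (λ b → m * b + c') (sym a≡a')))
  where
  a≡a' : a ≡ a'
  a≡a' = ≤-antisym (lex-≤⇒≤ (≤-reflexive eq) c'<m) (lex-≤⇒≤ (≤-reflexive (sym eq)) c<m)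

toℕ-pred : ∀ {k} (p : Fin k) {n} → toℕ p ≡ suc n → toℕ (F.pred p) ≡ n
toℕ-pred (suc p) p≡1+n = trans (toℕ-inject₁ p) (suc-injective p≡1+n)

module SweepSchedule (m k₀ : ℕ) (G : Graph (suc m)) where
  open Construction G (suc k₀)

  -- Bags are indexed by moments, ordered lexicographically by position, line, phase and tick.
  -- k' is hidden behind M so that it is never normalised; a phase has P = M + 2 ticks, enough
  -- for every family of pendant vertices and making 0F and 1F ticks by definition.
  opaque
    M : ℕ
    M = k'

  N K P L : ℕ
  N = suc m
  K = suc k₀
  P = suc (suc M)
  L = 4 * P

  Time : Set
  Time = Fin (N * N * K * L)

  record Moment : Set where
    constructor ⟨_,_,_,_⟩
    field
      position   : Fin (N * N)
      line     : Fin K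
      phase    : Fin 4
      tick     : Fin P

  encode : Moment → Time
  encode ⟨ p , j , φ , q ⟩ = combine (combine p j) (combine φ q)

  moment : Fin (N * N) × Fin K → Fin 4 × Fin P → Moment
  moment (p , j) (φ , q) = ⟨ p , j , φ , q ⟩

  decode : Time → Moment
  decode t = moment (remQuot {N * N} K (quotient {N * N * K} L t))
                    (remQuot {4} P (remainder {N * N * K} L t))

  decode-encode : ∀ μ → decode (encode μ) ≡ μ
  decode-encode ⟨ p , j , φ , q ⟩ = cong₂ moment
    (trans (cong (remQuot {N * N} K ∘ proj₁) split) (remQuot-combine p j))
    (trans (cong (remQuot {4} P ∘ proj₂) split) (remQuot-combine φ q))
    where
    split : remQuot L (combine (combine p j) (combine φ q)) ≡ (combine p j , combine φ q)
    split = remQuot-combine (combine p j) (combine φ q)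

  encode-decode : ∀ t → encode (decode t) ≡ t
  encode-decode t = trans
    (cong₂ (combine {N * N * K} {L}) (combine-remQuot {N * N} K (quotient {N * N * K} L t))
                                     (combine-remQuot {4} P (remainder {N * N * K} L t)))
    (combine-remQuot {N * N * K} L t)

  decode-injective : ∀ t t′ → decode t ≡ decode t′ → t ≡ t′
  decode-injective t t′ eq = trans (sym (encode-decode t)) (trans (cong encode eq) (encode-decode t′))

  clock : ℕ → ℕ → ℕ → ℕ
  clock p j s = L * (K * p + j) + s

  instant : Fin 4 → Fin P → ℕ
  instant φ q = P * toℕ φ + toℕ q

  toℕ-encode : ∀ p j φ q → toℕ (encode ⟨ p , j , φ , q ⟩) ≡ clock (toℕ p) (toℕ j) (instant φ q)
  toℕ-encode p j φ q = trans (toℕ-combine (combine p j) (combine φ q))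
                             (cong₂ (λ e s → L * e + s) (toℕ-combine p j) (toℕ-combine φ q))

  instant<L : ∀ φ q → instant φ q < L
  instant<L φ q = subst (_< L) (toℕ-combine φ q) (toℕ<n (combine φ q))

  instant-origin : instant 0F 0F ≡ 0
  instant-origin = cong (_+ 0) (*-zeroʳ P)

  instant-< : ∀ φ q {n} → toℕ φ < n → instant φ q < P * n
  instant-< φ q φ<n = subst (instant φ q <_) (+-identityʳ _) (lex-< (toℕ<n q) φ<n)

  instant-≥ : ∀ φ q {n} → n ≤ toℕ φ → P * n ≤ instant φ q
  instant-≥ φ q n≤φ = ≤-trans (*-monoʳ-≤ P n≤φ) (m≤m+n (P * toℕ φ) (toℕ q))

  0<L : 0 < L
  0<L = s≤s z≤n

  P*2<L : P * 2 < L
  P*2<L = subst (P * 2 <_) (*-comm P 4) (*-monoʳ-< P {2} {4} (s≤s (s≤s (s≤s z≤n))))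

  positionOf : Fin N → Fin N → Fin (N * N)
  positionOf = combine

  blockOf copyOf : Fin (N * N) → Fin N
  blockOf = quotient {N} N
  copyOf  = remainder {N} N

  positionOf-blockOf-copyOf : ∀ p → positionOf (blockOf p) (copyOf p) ≡ p
  positionOf-blockOf-copyOf = combine-remQuot {N} N

  blockOf-positionOf : ∀ i w → blockOf (positionOf i w) ≡ i
  blockOf-positionOf i w = cong proj₁ (remQuot-combine {N} {N} i w)

  copyOf-positionOf : ∀ i w → copyOf (positionOf i w) ≡ w
  copyOf-positionOf i w = cong proj₂ (remQuot-combine {N} {N} i w)

  toℕ-positionOf : ∀ i w → toℕ (positionOf i w) ≡ N * toℕ i + toℕ w
  toℕ-positionOf = toℕ-combine {N} {N}

  toℕ-positionOf≡pos : ∀ i w → toℕ (positionOf i w) ≡ pos i w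
  toℕ-positionOf≡pos i w = trans (toℕ-positionOf i w) (cong (_+ toℕ w) (*-comm N (toℕ i)))

  toℕ-split : ∀ p → toℕ p ≡ N * toℕ (blockOf p) + toℕ (copyOf p)
  toℕ-split p =
    trans (cong toℕ (sym (positionOf-blockOf-copyOf p))) (toℕ-positionOf (blockOf p) (copyOf p))

  neighbour? : ∀ i w → Dec (N[ i ]∋ w)
  neighbour? i w = T? _

  -- univ belongs to every bag, so it fills a slot that has nothing to hold.
  ifNeighbour : ∀ i w → (N[ i ]∋ w → V') → V'
  ifNeighbour i w f with neighbour? i w
  ... | yes h = f h
  ... | no _  = univ

  ifNeighbour-yes : ∀ {i w} (f : N[ i ]∋ w → V') h → ifNeighbour i w f ≡ f h
  ifNeighbour-yes {i} {w} f h with neighbour? i w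
  ... | yes h′ = cong f (T-irrelevant h′ h)
  ... | no ¬h  = contradiction h ¬h

  pendant : ∀ {c} → (Fin c → V') → Fin P → V'
  pendant {c} f q with toℕ q <? c
  ... | yes q<c = f (fromℕ< q<c)
  ... | no _    = univ

  pendant-inject≤ : ∀ {c} (f : Fin c → V') .(c≤P : c ≤ P) q → pendant f (inject≤ q c≤P) ≡ f q
  pendant-inject≤ {c} f c≤P q with toℕ (inject≤ q c≤P) <? c
  ... | yes q<c = cong f (toℕ-injective (trans (toℕ-fromℕ< q<c) (toℕ-inject≤ q c≤P)))
  ... | no q≮c  = contradiction (subst (_< c) (sym (toℕ-inject≤ q c≤P)) (toℕ<n q)) q≮c

  opaque
    unfolding M

    k′∸≤P : ∀ c → k' ∸ c ≤ P
    k′∸≤P c = m≤n⇒m≤1+n (m≤n⇒m≤1+n (m∸n≤m k' c))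

    k′∸N+1≤P : k' ∸ N + 1 ≤ P
    k′∸N+1≤P = m≤n⇒m≤1+n (subst (k' ∸ N + 1 ≤_) (+-comm k' 1) (+-monoˡ-≤ 1 (m∸n≤m k' N)))

  -- The vertex at position 0 of a cycle stays in every bag: it is adjacent to the last one.
  CycleSpan : Fin (N * N) → Fin K → Time → Set
  CycleSpan p j t =
    p ≡ 0F ⊎ (clock (toℕ p) (toℕ j) 0 ≤ toℕ t × toℕ t ≤ clock (suc (toℕ p)) (toℕ j) 0)

  XWindow : Fin 4 → Fin P → Set
  XWindow φ q = 0 < instant φ q × instant φ q < P * 2

  Alive : V' → Time → Set
  Alive (cyc j i w)    t = CycleSpan (positionOf i w) j t
  Alive (pc j i q)     t = decode t ≡ ⟨ positionOf i 0F , j , 2F , inject≤ q k′∸N+1≤P ⟩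
  Alive (z i)          t = clock (N * toℕ i) 0 0 ≤ toℕ t × toℕ t < clock (N * suc (toℕ i)) 0 0
  Alive (pz i q)       t = decode t ≡ ⟨ positionOf i 0F , 0F , 3F , inject≤ q (k′∸≤P (K * (δ i + 1))) ⟩
  Alive (x i j w _)    t = clock (toℕ (positionOf i w)) (toℕ j) 0 < toℕ t
                         × toℕ t < clock (toℕ (positionOf i w)) (toℕ j) (P * 2)
  Alive (y i j w _)    t = decode t ≡ ⟨ positionOf i w , j , 0F , 1F ⟩
  Alive (px i j w _ q) t = decode t ≡ ⟨ positionOf i w , j , 1F , inject≤ q (k′∸≤P 1) ⟩
  Alive univ           _ = ⊤

  point-convex : ∀ {i j l : Time} {μ} → toℕ i ≤ toℕ j → toℕ j ≤ toℕ l →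
                 decode i ≡ μ → decode l ≡ μ → decode j ≡ μ
  point-convex {i} {j} {l} i≤j j≤l di dl with refl ← decode-injective i l (trans di (sym dl)) =
    subst (λ t → decode t ≡ _) (toℕ-injective (≤-antisym i≤j j≤l)) di

  Alive-convex : ∀ v {i j l : Time} → toℕ i ≤ toℕ j → toℕ j ≤ toℕ l →
                 Alive v i → Alive v l → Alive v j
  Alive-convex (cyc _ _ _) _ _ (inj₁ p≡0) _ = inj₁ p≡0
  Alive-convex (cyc _ _ _) _ _ (inj₂ _) (inj₁ p≡0) = inj₁ p≡0
  Alive-convex (cyc _ _ _) i≤j j≤l (inj₂ (lo , _)) (inj₂ (_ , hi)) =
    inj₂ (≤-trans lo i≤j , ≤-trans j≤l hi)
  Alive-convex (pc _ _ _)     = point-convex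
  Alive-convex (z _) i≤j j≤l (lo , _) (_ , hi) = ≤-trans lo i≤j , ≤-<-trans j≤l hi
  Alive-convex (pz _ _)       = point-convex
  Alive-convex (x _ _ _ _) i≤j j≤l (lo , _) (_ , hi) = <-≤-trans lo i≤j , ≤-<-trans j≤l hi
  Alive-convex (y _ _ _ _)    = point-convex
  Alive-convex (px _ _ _ _ _) = point-convex
  Alive-convex univ _ _ _ _   = tt

  cycleVertex : Fin K → Fin (N * N) → V'
  cycleVertex j p = cyc j (blockOf p) (copyOf p)

  xVertex : Fin (N * N) → Fin K → V'
  xVertex p j = ifNeighbour (blockOf p) (copyOf p) (x (blockOf p) j (copyOf p))

  -- Phase 0 hands the cycle vertex of the current line over to its successor (tick 0) and meets
  -- y (tick 1); phases 1, 2 and 3 list, one per tick, the pendants of x, of the cycle vertex at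
  -- the first copy of a block, and of z at the first copy and line.
  primaryAt : Fin (N * N) → Fin K → Fin 4 → Fin P → V'
  primaryAt p j 0F 0F      = cycleVertex j (F.pred p)
  primaryAt p j 0F (suc _) = xVertex p j
  primaryAt p j 1F _       = xVertex p j
  primaryAt _ _ 2F _       = univ
  primaryAt _ _ 3F _       = univ

  secondaryAt : Fin N → Fin N → Fin K → Fin 4 → Fin P → V'
  secondaryAt _ _ _ 0F 0F            = univ
  secondaryAt i w j 0F 1F            = ifNeighbour i w (y i j w)
  secondaryAt _ _ _ 0F (suc (suc _)) = univ
  secondaryAt i w j 1F q             = ifNeighbour i w λ h → pendant (px i j w h) q
  secondaryAt i 0F j 2F q            = pendant (pc j i) q
  secondaryAt _ (suc _) _ 2F _       = univ
  secondaryAt i 0F 0F 3F q           = pendant (pz i) q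
  secondaryAt _ 0F (suc _) 3F _      = univ
  secondaryAt _ (suc _) _ 3F _       = univ

  -- Lines up to the current one have advanced to position p, the others are still at p - 1
  -- (at position 0, F.pred gives the first vertex again).
  frontAt : Fin K → Fin (N * N) → Fin K → V'
  frontAt j₀ p j with toℕ j₀ ≤? toℕ j
  ... | yes _ = cycleVertex j₀ p
  ... | no _  = cycleVertex j₀ (F.pred p)

  data Slot : Set where
    hub centre primary secondary : Slot
    origin front : Fin K → Slot

  occupantAt : Moment → Slot → V'
  occupantAt _                 hub         = univ
  occupantAt ⟨ p , _ , _ , _ ⟩ centre      = z (blockOf p)
  occupantAt ⟨ p , j , φ , q ⟩ primary     = primaryAt p j φ q
  occupantAt ⟨ p , j , φ , q ⟩ secondary   = secondaryAt (blockOf p) (copyOf p) j φ q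
  occupantAt _                 (origin j₀) = cyc j₀ 0F 0F
  occupantAt ⟨ p , j , _ , _ ⟩ (front j₀)  = frontAt j₀ p j

  slots : List Slot
  slots = hub ∷ centre ∷ primary ∷ secondary ∷ map origin (allFin K) ++ map front (allFin K)

  ∈-slots : ∀ σ → σ ∈ slots
  ∈-slots hub        = here refl
  ∈-slots centre     = there (here refl)
  ∈-slots primary    = there (there (here refl))
  ∈-slots secondary  = there (there (there (here refl)))
  ∈-slots (origin j) = there (there (there (there (∈-++⁺ˡ (∈-map⁺ origin (∈-allFin j))))))
  ∈-slots (front j)  =
    there (there (there (there (∈-++⁺ʳ (map origin (allFin K)) (∈-map⁺ front (∈-allFin j))))))

  length-slots : length slots ≤ 2 * K + 4
  length-slots = ≤-reflexive (begin
    4 + length (map origin (allFin K) ++ map front (allFin K))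
      ≡⟨ cong (4 +_) (length-++ (map origin (allFin K))) ⟩
    4 + (length (map origin (allFin K)) + length (map front (allFin K)))
      ≡⟨ cong₂ (λ a b → 4 + (a + b)) (length-lines origin) (length-lines front) ⟩
    4 + (K + K)
      ≡⟨ +-comm 4 (K + K) ⟩
    K + K + 4
      ≡⟨ cong (λ b → K + b + 4) (+-identityʳ K) ⟨
    2 * K + 4 ∎)
    where
    open ≡-Reasoning
    length-lines : (f : Fin K → Slot) → length (map f (allFin K)) ≡ K
    length-lines f = trans (length-map f (allFin K)) (length-tabulate (λ j → j))

  ifNeighbour-alive : ∀ i w t (f : N[ i ]∋ w → V') →
                      (∀ h → Alive (f h) t) → Alive (ifNeighbour i w f) t
  ifNeighbour-alive i w t f alive with neighbour? i w
  ... | yes h = alive h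
  ... | no _  = tt

  pendant-alive : ∀ {c} (f : Fin c → V') .(c≤P : c ≤ P) p j φ q →
                  (∀ q′ → Alive (f q′) (encode ⟨ p , j , φ , inject≤ q′ c≤P ⟩)) →
                  Alive (pendant f q) (encode ⟨ p , j , φ , q ⟩)
  pendant-alive {c} f c≤P p j φ q alive with toℕ q <? c
  ... | yes q<c = subst (λ q′ → Alive (f (fromℕ< q<c)) (encode ⟨ p , j , φ , q′ ⟩))
                        (toℕ-injective (trans (toℕ-inject≤ _ c≤P) (toℕ-fromℕ< q<c)))
                        (alive (fromℕ< q<c))
  ... | no _    = tt

  alive-positionOf-split : ∀ v p j φ q →
                           Alive v (encode ⟨ positionOf (blockOf p) (copyOf p) , j , φ , q ⟩) →
                           Alive v (encode ⟨ p , j , φ , q ⟩)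
  alive-positionOf-split v p j φ q =
    subst (λ p′ → Alive v (encode ⟨ p′ , j , φ , q ⟩)) (positionOf-blockOf-copyOf p)

  cycleVertex-alive : ∀ j p t → CycleSpan p j t → Alive (cycleVertex j p) t
  cycleVertex-alive j p t = subst (λ p′ → CycleSpan p′ j t) (sym (positionOf-blockOf-copyOf p))

  cycleSpan-here : ∀ {p j₀} j φ q → toℕ j₀ ≤ toℕ j → CycleSpan p j₀ (encode ⟨ p , j , φ , q ⟩)
  cycleSpan-here {p} {j₀} j φ q j₀≤j =
    inj₂ (≤-trans lo (≤-reflexive (sym t≡)) , ≤-trans (≤-reflexive t≡) hi)
    where
    t≡ = toℕ-encode p j φ q
    lo : clock (toℕ p) (toℕ j₀) 0 ≤ clock (toℕ p) (toℕ j) (instant φ q)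
    lo = +-mono-≤ (*-monoʳ-≤ L (+-monoʳ-≤ (K * toℕ p) j₀≤j)) z≤n
    hi : clock (toℕ p) (toℕ j) (instant φ q) ≤ clock (suc (toℕ p)) (toℕ j₀) 0
    hi = <⇒≤ (lex-< (instant<L φ q) (lex-< (toℕ<n j) (n<1+n (toℕ p))))

  cycleSpan-next : ∀ {p′ p} j₀ j φ q → toℕ p′ ≡ suc (toℕ p) →
                   clock (toℕ p′) (toℕ j) (instant φ q) ≤ clock (toℕ p′) (toℕ j₀) 0 →
                   CycleSpan p j₀ (encode ⟨ p′ , j , φ , q ⟩)
  cycleSpan-next {p′} {p} j₀ j φ q p′≡1+p hi =
    inj₂ (≤-trans lo (≤-reflexive (sym t≡)) , ≤-trans (≤-reflexive t≡) hi′)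
    where
    t≡ = toℕ-encode p′ j φ q
    lo : clock (toℕ p) (toℕ j₀) 0 ≤ clock (toℕ p′) (toℕ j) (instant φ q)
    lo = <⇒≤ (lex-< 0<L (lex-< (toℕ<n j₀) (≤-reflexive (sym p′≡1+p))))
    hi′ : clock (toℕ p′) (toℕ j) (instant φ q) ≤ clock (suc (toℕ p)) (toℕ j₀) 0
    hi′ = subst (λ n → clock (toℕ p′) (toℕ j) (instant φ q) ≤ clock n (toℕ j₀) 0) p′≡1+p hi

  cycleVertex-pred-alive : ∀ p j₀ j φ q →
                           clock (toℕ p) (toℕ j) (instant φ q) ≤ clock (toℕ p) (toℕ j₀) 0 →
                           Alive (cycleVertex j₀ (F.pred p)) (encode ⟨ p , j , φ , q ⟩)
  cycleVertex-pred-alive 0F      j₀ j φ q _  =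
    cycleVertex-alive j₀ 0F (encode ⟨ 0F , j , φ , q ⟩) (inj₁ refl)
  cycleVertex-pred-alive (suc p) j₀ j φ q hi =
    cycleVertex-alive j₀ (inject₁ p) (encode ⟨ suc p , j , φ , q ⟩)
                      (cycleSpan-next j₀ j φ q (cong suc (sym (toℕ-inject₁ p))) hi)

  front-alive : ∀ j₀ p j φ q → Alive (frontAt j₀ p j) (encode ⟨ p , j , φ , q ⟩)
  front-alive j₀ p j φ q with toℕ j₀ ≤? toℕ j
  ... | yes j₀≤j = cycleVertex-alive j₀ p (encode ⟨ p , j , φ , q ⟩) (cycleSpan-here j φ q j₀≤j)
  ... | no j₀≰j  =
    cycleVertex-pred-alive p j₀ j φ q (<⇒≤ (lex-< (instant<L φ q) (+-monoʳ-< (K * toℕ p) (≰⇒> j₀≰j))))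

  centre-alive : ∀ i w j φ q → Alive (z i) (encode ⟨ positionOf i w , j , φ , q ⟩)
  centre-alive i w j φ q = ≤-trans lo (≤-reflexive (sym t≡)) , ≤-<-trans (≤-reflexive t≡) hi
    where
    p = positionOf i w
    t≡ = toℕ-encode p j φ q
    p≡ = toℕ-positionOf i w
    lo : clock (N * toℕ i) 0 0 ≤ clock (toℕ p) (toℕ j) (instant φ q)
    lo = +-mono-≤ (*-monoʳ-≤ L (+-mono-≤ (*-monoʳ-≤ K Ni≤p) z≤n)) z≤n
      where
      Ni≤p = ≤-trans (m≤m+n (N * toℕ i) (toℕ w)) (≤-reflexive (sym p≡))
    hi : clock (toℕ p) (toℕ j) (instant φ q) < clock (N * suc (toℕ i)) 0 0
    hi = lex-< (instant<L φ q) (lex-< (toℕ<n j)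
           (subst (_< N * suc (toℕ i)) (sym p≡) (lex-<-boundary (toℕ<n w) (n<1+n (toℕ i)))))

  window-tick : ∀ q → XWindow 0F (suc q)
  window-tick q =
    ≤-trans (s≤s z≤n) (m≤n+m (suc (toℕ q)) (P * 0)) , instant-< 0F (suc q) {2} (s≤s z≤n)

  window-pendant : ∀ q → XWindow 1F q
  window-pendant q = s≤s z≤n , instant-< 1F q {2} (s≤s (s≤s z≤n))

  x-alive : ∀ i j w h φ q → XWindow φ q → Alive (x i j w h) (encode ⟨ positionOf i w , j , φ , q ⟩)
  x-alive i j w h φ q (0<s , s<2P) =
    <-≤-trans lo (≤-reflexive (sym t≡)) , ≤-<-trans (≤-reflexive t≡) hi
    where
    e = K * toℕ (positionOf i w) + toℕ j
    t≡ = toℕ-encode (positionOf i w) j φ q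
    lo : L * e + 0 < L * e + instant φ q
    lo = +-monoʳ-< (L * e) 0<s
    hi : L * e + instant φ q < L * e + P * 2
    hi = +-monoʳ-< (L * e) s<2P

  x-alive-with-y : ∀ i j w h → Alive (x i j w h) (encode ⟨ positionOf i w , j , 0F , 1F ⟩)
  x-alive-with-y i j w h = x-alive i j w h 0F 1F (window-tick 0F)

  xVertex-alive : ∀ p j φ q → XWindow φ q → Alive (xVertex p j) (encode ⟨ p , j , φ , q ⟩)
  xVertex-alive p j φ q window = ifNeighbour-alive i w (encode ⟨ p , j , φ , q ⟩) _ λ h →
    alive-positionOf-split (x i j w h) p j φ q (x-alive i j w h φ q window)
    where
    i = blockOf p
    w = copyOf p

  primary-alive : ∀ p j φ q → Alive (primaryAt p j φ q) (encode ⟨ p , j , φ , q ⟩)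
  primary-alive p j 0F 0F      =
    cycleVertex-pred-alive p j j 0F 0F (≤-reflexive (cong (clock (toℕ p) (toℕ j)) instant-origin))
  primary-alive p j 0F (suc q) = xVertex-alive p j 0F (suc q) (window-tick q)
  primary-alive p j 1F q       = xVertex-alive p j 1F q (window-pendant q)
  primary-alive _ _ 2F _       = tt
  primary-alive _ _ 3F _       = tt

  secondary-alive : ∀ i w j φ q →
                    Alive (secondaryAt i w j φ q) (encode ⟨ positionOf i w , j , φ , q ⟩)
  secondary-alive _ _ _ 0F 0F            = tt
  secondary-alive i w j 0F 1F            = ifNeighbour-alive i w _ (y i j w) λ _ → decode-encode _
  secondary-alive _ _ _ 0F (suc (suc _)) = tt
  secondary-alive i w j 1F q             = ifNeighbour-alive i w _ _ λ h →
    pendant-alive (px i j w h) (k′∸≤P 1) (positionOf i w) j 1F q λ _ → decode-encode _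
  secondary-alive i 0F j 2F q            =
    pendant-alive (pc j i) k′∸N+1≤P (positionOf i 0F) j 2F q λ _ → decode-encode _
  secondary-alive _ (suc _) _ 2F _       = tt
  secondary-alive i 0F 0F 3F q           =
    pendant-alive (pz i) (k′∸≤P (K * (δ i + 1))) (positionOf i 0F) 0F 3F q λ _ → decode-encode _
  secondary-alive _ 0F (suc _) 3F _      = tt
  secondary-alive _ (suc _) _ 3F _       = tt

  occupantAt-alive : ∀ μ σ → Alive (occupantAt μ σ) (encode μ)
  occupantAt-alive _                 hub        = tt
  occupantAt-alive ⟨ p , j , φ , q ⟩ centre     =
    alive-positionOf-split (z (blockOf p)) p j φ q (centre-alive (blockOf p) (copyOf p) j φ q)
  occupantAt-alive ⟨ p , j , φ , q ⟩ primary    = primary-alive p j φ q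
  occupantAt-alive ⟨ p , j , φ , q ⟩ secondary  =
    alive-positionOf-split (secondaryAt (blockOf p) (copyOf p) j φ q) p j φ q
                           (secondary-alive (blockOf p) (copyOf p) j φ q)
  occupantAt-alive _                 (origin _) = inj₁ refl
  occupantAt-alive ⟨ p , j , φ , q ⟩ (front j₀) = front-alive j₀ p j φ q

  x-window : ∀ {e e′ s′} → s′ < L → L * e + 0 < L * e′ + s′ → L * e′ + s′ < L * e + P * 2 →
             e′ ≡ e × 0 < s′ × s′ < P * 2
  x-window {e} {e′} {s′} s′<L lo hi =
    e′≡e , +-cancelˡ-< (L * e) 0 s′ lo′ , +-cancelˡ-< (L * e) s′ (P * 2) hi′
    where
    e′≡e : e′ ≡ e
    e′≡e = ≤-antisym (lex-≤⇒≤ (<⇒≤ hi) P*2<L) (lex-≤⇒≤ (<⇒≤ lo) s′<L)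
    lo′ : L * e + 0 < L * e + s′
    lo′ = subst (λ e″ → L * e + 0 < L * e″ + s′) e′≡e lo
    hi′ : L * e + s′ < L * e + P * 2
    hi′ = subst (λ e″ → L * e″ + s′ < L * e + P * 2) e′≡e hi

  block-window : ∀ {i b w j s} → w < N → j < K → s < L →
                 clock (N * i) 0 0 ≤ clock (N * b + w) j s →
                 clock (N * b + w) j s < clock (N * suc i) 0 0 → b ≡ i
  block-window {i} {b} {w} {j} {s} w<N j<K s<L lo hi = ≤-antisym b≤i i≤b
    where
    step≤ : K * (N * i) + 0 ≤ K * (N * b + w) + j
    step≤ = lex-≤⇒≤ {m = L} {a = K * (N * i) + 0} {a' = K * (N * b + w) + j} lo s<L
    i≤b : i ≤ b
    i≤b = lex-≤⇒≤ {m = N} {a = i} {a' = b}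
            (subst (_≤ N * b + w) (sym (+-identityʳ (N * i)))
                   (lex-≤⇒≤ {m = K} {a = N * i} {a' = N * b + w} step≤ j<K))
            w<N
    step< : K * (N * b + w) + j < K * (N * suc i) + 0
    step< = lex-<⇒< {m = L} {a = K * (N * b + w) + j} {a' = K * (N * suc i) + 0} hi z≤n
    position< : N * b + w < N * suc i + 0
    position< = subst (N * b + w <_) (sym (+-identityʳ (N * suc i)))
                      (lex-<⇒< {m = K} {a = N * b + w} {a' = N * suc i} step< z≤n)
    b≤i : b ≤ i
    b≤i = ≤-pred (lex-<⇒< {m = N} {a = b} {a' = suc i} position< z≤n)

  cycle-window : ∀ {p j p′ j′ s′} → j < K → j′ < K → s′ < L →
                 clock p j 0 ≤ clock p′ j′ s′ → clock p′ j′ s′ ≤ clock (suc p) j 0 →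
                 (p′ ≡ p × j ≤ j′) ⊎ (p′ ≡ suc p × (j′ < j ⊎ (j′ ≡ j × s′ ≡ 0)))
  cycle-window {p} {j} {p′} {j′} {s′} j<K j′<K s′<L lo hi = cases (m≤n⇒m<n∨m≡n hi)
    where
    e≤e′ : K * p + j ≤ K * p′ + j′
    e≤e′ = lex-≤⇒≤ lo s′<L

    same-or-next : p′ < suc p ⊎ p′ ≡ suc p → K * p′ + j′ < K * suc p + j →
                   (p′ ≡ p × j ≤ j′) ⊎ (p′ ≡ suc p × (j′ < j ⊎ (j′ ≡ j × s′ ≡ 0)))
    same-or-next (inj₁ p′<1+p) _ =
      inj₁ (p′≡p , +-cancelˡ-≤ (K * p) j j′ (subst (λ n → K * p + j ≤ K * n + j′) p′≡p e≤e′))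
      where
      p′≡p = ≤-antisym (≤-pred p′<1+p) (lex-≤⇒≤ e≤e′ j′<K)
    same-or-next (inj₂ p′≡1+p) e′<e″ =
      inj₂ (p′≡1+p , inj₁ (+-cancelˡ-< (K * suc p) j′ j
                             (subst (λ n → K * n + j′ < K * suc p + j) p′≡1+p e′<e″)))

    cases : clock p′ j′ s′ < clock (suc p) j 0 ⊎ clock p′ j′ s′ ≡ clock (suc p) j 0 →
            (p′ ≡ p × j ≤ j′) ⊎ (p′ ≡ suc p × (j′ < j ⊎ (j′ ≡ j × s′ ≡ 0)))
    cases (inj₁ lt) = same-or-next (m≤n⇒m<n∨m≡n (lex-≤⇒≤ (<⇒≤ e′<e″) j<K)) e′<e″
      where
      e′<e″ : K * p′ + j′ < K * suc p + j
      e′<e″ = lex-<⇒< {m = L} lt z≤n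
    cases (inj₂ eq) = inj₂ (proj₁ digits , inj₂ (proj₂ digits , proj₂ step))
      where
      step : K * p′ + j′ ≡ K * suc p + j × s′ ≡ 0
      step = lex-injective {m = L} {a = K * p′ + j′} {a' = K * suc p + j} s′<L 0<L eq
      digits : p′ ≡ suc p × j′ ≡ j
      digits = lex-injective j′<K j<K (proj₁ step)

  cycleVertex-≡ : ∀ {j p} i w → toℕ p ≡ toℕ (positionOf i w) → cycleVertex j p ≡ cyc j i w
  cycleVertex-≡ {j} i w p≡ with refl ← toℕ-injective p≡ =
    cong₂ (cyc j) (blockOf-positionOf i w) (copyOf-positionOf i w)

  xVertex-≡ : ∀ i j w h → xVertex (positionOf i w) j ≡ x i j w h
  xVertex-≡ i j w h rewrite blockOf-positionOf i w | copyOf-positionOf i w = ifNeighbour-yes (x i j w) h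

  frontAt-≤ : ∀ j₀ p j → toℕ j₀ ≤ toℕ j → frontAt j₀ p j ≡ cycleVertex j₀ p
  frontAt-≤ j₀ p j j₀≤j with toℕ j₀ ≤? toℕ j
  ... | yes _   = refl
  ... | no j₀≰j = contradiction j₀≤j j₀≰j

  frontAt-> : ∀ j₀ p j → toℕ j < toℕ j₀ → frontAt j₀ p j ≡ cycleVertex j₀ (F.pred p)
  frontAt-> j₀ p j j<j₀ with toℕ j₀ ≤? toℕ j
  ... | yes j₀≤j = contradiction j₀≤j (<⇒≱ j<j₀)
  ... | no _     = refl

  primaryAt-handover : ∀ p j φ q → instant φ q ≡ 0 → primaryAt p j φ q ≡ cycleVertex j (F.pred p)
  primaryAt-handover p j 0F 0F      _   = refl
  primaryAt-handover p j 0F (suc q) s≡0 = contradiction s≡0 (>⇒≢ (proj₁ (window-tick q)))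
  primaryAt-handover p j 1F q       ()
  primaryAt-handover p j 2F q       ()
  primaryAt-handover p j 3F q       ()

  primaryAt-window : ∀ p j φ q → XWindow φ q → primaryAt p j φ q ≡ xVertex p j
  primaryAt-window p j 0F 0F      (0<s , _)  = contradiction (sym instant-origin) (<⇒≢ 0<s)
  primaryAt-window p j 0F (suc q) _          = refl
  primaryAt-window p j 1F q       _          = refl
  primaryAt-window p j 2F q       (_ , s<2P) = contradiction s<2P (≤⇒≯ (instant-≥ 2F q (s≤s (s≤s z≤n))))
  primaryAt-window p j 3F q       (_ , s<2P) = contradiction s<2P (≤⇒≯ (instant-≥ 3F q (s≤s (s≤s z≤n))))

  occupantAt-secondary : ∀ i w j φ q →
                         occupantAt ⟨ positionOf i w , j , φ , q ⟩ secondary ≡ secondaryAt i w j φ q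
  occupantAt-secondary i w j φ q =
    cong₂ (λ i′ w′ → secondaryAt i′ w′ j φ q) (blockOf-positionOf i w) (copyOf-positionOf i w)

  cyc-occupant : ∀ j i w μ → Alive (cyc j i w) (encode μ) → ∃[ σ ] occupantAt μ σ ≡ cyc j i w
  cyc-occupant j i w _ (inj₁ p≡0) =
    origin j , cong₂ (cyc j) (sym (proj₁ origin≡)) (sym (proj₂ origin≡))
    where
    origin≡ = combine-injective i w 0F 0F p≡0
  cyc-occupant j i w ⟨ p′ , j′ , φ , q ⟩ (inj₂ (lo , hi))
    with cycle-window (toℕ<n j) (toℕ<n j′) (instant<L φ q)
                      (≤-trans lo (≤-reflexive t≡)) (≤-trans (≤-reflexive (sym t≡)) hi)
    where
    t≡ = toℕ-encode p′ j′ φ q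
  ... | inj₁ (p′≡ , j≤j′) = front j , trans (frontAt-≤ j p′ j′ j≤j′) (cycleVertex-≡ i w p′≡)
  ... | inj₂ (p′≡ , inj₁ j′<j) =
    front j , trans (frontAt-> j p′ j′ j′<j) (cycleVertex-≡ i w (toℕ-pred p′ p′≡))
  ... | inj₂ (p′≡ , inj₂ (j′≡j , s≡0)) with refl ← toℕ-injective {i = j′} {j = j} j′≡j =
    primary , trans (primaryAt-handover p′ j φ q s≡0) (cycleVertex-≡ i w (toℕ-pred p′ p′≡))

  x-occupant : ∀ i j w h μ → Alive (x i j w h) (encode μ) → ∃[ σ ] occupantAt μ σ ≡ x i j w h
  x-occupant i j w h ⟨ p′ , j′ , φ , q ⟩ (lo , hi)
    with x-window (instant<L φ q) (<-≤-trans lo (≤-reflexive t≡)) (≤-<-trans (≤-reflexive (sym t≡)) hi)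
    where
    t≡ = toℕ-encode p′ j′ φ q
  ... | step≡ , window
    with lex-injective {m = K} {a = toℕ p′} {a' = toℕ (positionOf i w)} (toℕ<n j′) (toℕ<n j) step≡
  ... | p′≡ , j′≡ with refl ← toℕ-injective p′≡ | refl ← toℕ-injective {i = j′} {j = j} j′≡ =
    primary , trans (primaryAt-window (positionOf i w) j φ q window) (xVertex-≡ i j w h)

  z-occupant : ∀ i μ → Alive (z i) (encode μ) → ∃[ σ ] occupantAt μ σ ≡ z i
  z-occupant i ⟨ p′ , j′ , φ , q ⟩ (lo , hi) =
    centre , cong z (toℕ-injective (block-window (toℕ<n (copyOf p′)) (toℕ<n j′) (instant<L φ q)
                                      (≤-trans lo (≤-reflexive t≡)) (≤-<-trans (≤-reflexive (sym t≡)) hi)))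
    where
    t≡ : toℕ (encode ⟨ p′ , j′ , φ , q ⟩)
         ≡ clock (N * toℕ (blockOf p′) + toℕ (copyOf p′)) (toℕ j′) (instant φ q)
    t≡ = trans (toℕ-encode p′ j′ φ q) (cong (λ n → clock n (toℕ j′) (instant φ q)) (toℕ-split p′))

  alive-occupantAt : ∀ v μ → Alive v (encode μ) → ∃[ σ ] occupantAt μ σ ≡ v
  alive-occupantAt (cyc j i w) μ alive = cyc-occupant j i w μ alive
  alive-occupantAt (pc j i q) μ μ≡ with refl ← trans (sym (decode-encode μ)) μ≡ =
    secondary , trans (occupantAt-secondary i 0F j 2F _) (pendant-inject≤ (pc j i) k′∸N+1≤P q)
  alive-occupantAt (z i) μ alive = z-occupant i μ alive
  alive-occupantAt (pz i q) μ μ≡ with refl ← trans (sym (decode-encode μ)) μ≡ =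
    secondary , trans (occupantAt-secondary i 0F 0F 3F _)
                      (pendant-inject≤ (pz i) (k′∸≤P (K * (δ i + 1))) q)
  alive-occupantAt (x i j w h) μ alive = x-occupant i j w h μ alive
  alive-occupantAt (y i j w h) μ μ≡ with refl ← trans (sym (decode-encode μ)) μ≡ =
    secondary , trans (occupantAt-secondary i w j 0F 1F) (ifNeighbour-yes (y i j w) h)
  alive-occupantAt (px i j w h q) μ μ≡ with refl ← trans (sym (decode-encode μ)) μ≡ =
    secondary , trans (occupantAt-secondary i w j 1F (inject≤ q (k′∸≤P 1)))
                      (trans (ifNeighbour-yes (λ h′ → pendant (px i j w h′) (inject≤ q (k′∸≤P 1))) h)
                             (pendant-inject≤ (px i j w h) (k′∸≤P 1) q))
  alive-occupantAt univ _ _ = hub , refl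

  decode-surjective : ∀ μ → ∃[ t ] decode t ≡ μ
  decode-surjective μ = encode μ , decode-encode μ

  alive-somewhere : ∀ v → ∃[ t ] Alive v t
  alive-somewhere (cyc j i w)    = _ , cycleSpan-here {positionOf i w} j 0F 0F ≤-refl
  alive-somewhere (pc j i q)     = decode-surjective _
  alive-somewhere (z i)          = _ , centre-alive i 0F 0F 0F 0F
  alive-somewhere (pz i q)       = decode-surjective _
  alive-somewhere (x i j w h)    = _ , x-alive-with-y i j w h
  alive-somewhere (y i j w h)    = decode-surjective _
  alive-somewhere (px i j w h q) = decode-surjective _
  alive-somewhere univ           = encode ⟨ 0F , 0F , 0F , 0F ⟩ , tt

  edge-alive : ∀ {u v} → E' u v → ∃[ t ] (Alive u t × Alive v t)
  edge-alive (cyc-e j b a b₁ a₁ (inj₁ next)) =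
    _ , cycleSpan-next {positionOf b₁ a₁} {positionOf b a} j j 0F 0F p₁≡1+p
          (≤-reflexive (cong (clock (toℕ (positionOf b₁ a₁)) (toℕ j)) instant-origin)) ,
        cycleSpan-here {positionOf b₁ a₁} j 0F 0F ≤-refl
    where
    p₁≡1+p : toℕ (positionOf b₁ a₁) ≡ suc (toℕ (positionOf b a))
    p₁≡1+p = trans (toℕ-positionOf≡pos b₁ a₁)
                   (trans (sym next) (cong suc (sym (toℕ-positionOf≡pos b a))))
  edge-alive (cyc-e j b a b₁ a₁ (inj₂ (_ , first≡0))) =
    _ , cycleSpan-here {positionOf b a} j 0F 0F ≤-refl ,
        inj₁ (toℕ-injective (trans (toℕ-positionOf≡pos b₁ a₁) first≡0))
  edge-alive (pc-e j b a q a≡0) with refl ← toℕ-injective {i = a} {j = 0F} a≡0 =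
    encode μ , decode-encode μ , cycleSpan-here {positionOf b 0F} j 2F q′ ≤-refl
    where
    q′ = inject≤ q k′∸N+1≤P
    μ = ⟨ positionOf b 0F , j , 2F , q′ ⟩
  edge-alive (pz-e i q) = encode μ , decode-encode μ , centre-alive i 0F 0F 3F q′
    where
    q′ = inject≤ q (k′∸≤P (K * (δ i + 1)))
    μ = ⟨ positionOf i 0F , 0F , 3F , q′ ⟩
  edge-alive (xy-e i j w h) = _ , x-alive-with-y i j w h , decode-encode _
  edge-alive (zy-e i j w h) = _ , centre-alive i w j 0F 1F , decode-encode _
  edge-alive (px-e i j w h q) = encode μ , decode-encode μ , x-alive i j w h 1F q′ (window-pendant q′)
    where
    q′ = inject≤ q (k′∸≤P 1)
    μ = ⟨ positionOf i w , j , 1F , q′ ⟩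
  edge-alive (xc-e i j a h) = _ , x-alive-with-y i j a h , cycleSpan-here {positionOf i a} j 0F 1F ≤-refl
  edge-alive (u-e v _) = let (t , alive) = alive-somewhere v in t , tt , alive

  schedule : Schedule V' E' (2 * K + 4)
  schedule = record
    { duration        = N * N * K * L
    ; Slot            = Slot
    ; slots           = slots
    ; ∈-slots         = ∈-slots
    ; length-slots    = length-slots
    ; occupant        = occupantAt ∘ decode
    ; Alive           = Alive
    ; Alive-convex    = Alive-convex
    ; occupant-alive  = λ t σ →
        subst (Alive (occupantAt (decode t) σ)) (encode-decode t) (occupantAt-alive (decode t) σ)
    ; alive-occupant  = λ {v} {t} alive →
        alive-occupantAt v (decode t) (subst (Alive v) (sym (encode-decode t)) alive)
    ; alive-somewhere = alive-somewhere
    ; edge-alive      = edge-alive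
    }

module SingleVertex (G : Graph 0) (k : ℕ) where
  open Construction G k

  only-univ : ∀ v → v ≡ univ
  only-univ (cyc _ () _)
  only-univ (pc _ () _)
  only-univ (z ())
  only-univ (pz () _)
  only-univ (x () _ _ _)
  only-univ (y () _ _ _)
  only-univ (px () _ _ _ _)
  only-univ univ = refl

  pathwidth≤ : PathwidthAtMost V' E' (2 * k + 4)
  pathwidth≤ = decomposition , λ _ → ≤-trans (s≤s z≤n) (m≤n+m 4 (2 * k))
    where
    decomposition : PathDecomposition V' E'
    decomposition = record
      { r      = 1
      ; bag    = λ _ → univ ∷ []
      ; covers = λ v → 0F , here (only-univ v)
      ; edges  = λ u v _ → 0F , here (only-univ u) , here (only-univ v)
      ; consec = λ _ _ _ _ _ _ v∈i _ → v∈i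
      }

lemma3 : ∀ {n : ℕ} (G : Graph n) (k : ℕ) → 1 ≤ k →
    PathwidthAtMost (Construction.V' G k) (Construction.E' G k) (2 * k + 4)
lemma3 {zero}  G k       _ = SingleVertex.pathwidth≤ G k
lemma3 {suc m} G (suc k) _ = schedule→pathwidth (SweepSchedule.schedule m k G)
lemma3 {suc _} _ zero    ()
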